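{- Under the standing assumptions below, the order $\mathcal{BL}^d_G$ is consistent with $\mathcal{BL}^k_{G_S}$ for every $S=\{i_1<\dots<i_k\}\subset\{1,\dots,d\}$ (nonempty).
   Context: All graphs are finite and simple. For $G=(V,E)$, $I_G(A,B)$ is the set of edges with one end in $A$ and the other in $B$, $I_G(A)=I_G(A,A)$, $I_G(m)=\max_{|S|=m}|I_G(S)|$. A total order is a bijection $\mathcal O:V\to\{1,\dots,|V|\}$, $\mathcal O[k,l]=\mathcal O^{ -1}(\{k,\dots,l\})$; it is optimal if $|I_G(\mathcal O[1,k])|=I_G(k)$ for all $k$; $G$ is isoperimetric if it has one. $\delta_G(1)=0$, $\delta_G(m)=I_G(m)-I_G(m-1)$. Cartesian product $G_1\square\cdots\square G_d$: tuples adjacent iff they differ in exactly one coordinate, where they are adjacent. Lexicographic order on $\mathbb R^k$: $x<y$ iff for some $i$, $x_1=y_1,\dots,x_i=y_i$, $x_{i+1}<y_{i+1}$. For $\pi\in\mathfrak S_k$, $\mathcal D^{\pi,k}$ compares $(x_{\pi(1)},\dots,x_{\pi(k)})$ lexicographically; orders on $\mathbb R^k$ induce orders on products of ordered sets via rank tuples. Isoperimetric partition of isoperimetric $G$ with optimal $\mathcal O_G$: partition into consecutive intervals $\mathcal O_G[a_i,b_i]$ such that each part induces an isoperimetric subgraph with the restricted order optimal, and every $v\in\mathcal O_G[a_i,b_i]$ has exactly $\delta_G(a_i)$ neighbours in $\mathcal O_G[a_1,b_{i-1}]$. Starts of parts are their first vertices. Non-decreasing: each part's induced subgraph has non-decreasing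 $\delta$-sequence. Regular: first and last parts' induced subgraphs have equal $\delta$-sequences. Setup: $G_i$ ($1\le i\le d$) isoperimetric with fixed optimal orders $\mathcal O_{G_i}$ and isoperimetric partitions $\mathfrak P_{G_i}$; $G=G_1\square\cdots\square G_d$; $G_S=G_{i_1}\square\cdots\square G_{i_k}$ for $S=\{i_1<\dots<i_k\}$. Blocks of $G_S$: $Z_{i_1}\times\cdots\times Z_{i_k}$, $Z_{i_j}\in\mathfrak P_{G_{i_j}}$; start: tuple of starts. An order $\mathcal O$ on a product is consistent with an order $\mathcal O'$ on the subproduct over $S$ if $x<_{\mathcal O}y$ and $x_j=y_j$ for $j\notin S$ imply $(x_{i_1},\dots,x_{i_k})<_{\mathcal O'}(y_{i_1},\dots,y_{i_k})$. Domination collection: each block $B$ of each $G_S$ has $\pi_B\in\mathfrak S_{|S|}$ such that the order $\mathcal D_B$ induced by $\mathcal D^{\pi_B,|S|}$ on $B$ (coordinates ranked by restrictions of $\mathcal O_{G_{i_j}}$) is optimal for the subgraph induced by $B$, and for $S_1\subset S_2$, $\mathcal D_{B_2}$ is consistent with $\mathcal D_{B_1}$ when $B_1$ consists of the factors of $B_2$ indexed by $S_1$. $\mathcal{BL}^k_{G_S}$: same block: compare by $\mathcal D_B$; different blocks: compare starts lexicographically (coordinates ranked by $\mathcal O_{G_{i_j}}$); $\mathcal{BL}^d_G=\mathcal{BL}^d_{G_{\{1,\dots,d\}}}$. Regular domination collection: $\mathfrak P_{G_i}$ regular for $2\le i\le d-1$, and $\pi_{B_1}=\pi_{B_2}$ for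 $B_1$ (resp. $B_2$) the product of the first (resp. last) parts of $\mathfrak P_{G_2},\dots,\mathfrak P_{G_{d-1}}$. Standing assumptions: $d\ge3$; the $\mathfrak P_{G_i}$ form a regular domination collection; $\mathfrak P_{G_i}$ is non-decreasing for $i\le d-1$; $\mathcal{BL}^2_{G_i\square G_j}$ is optimal for all $i<j$. -}

module Defs where

open import Data.Bool using (Bool; true; false; _∧_; _∨_; not; if_then_else_)
open import Data.Nat using (ℕ; zero; suc; _+_; _∸_; _≤_; _<_; _⊔_; _≡ᵇ_; _<ᵇ_; _≤ᵇ_)
open import Data.Fin using (Fin; toℕ; splitAt)
open import Data.Fin.Permutation using (Permutation′; _⟨$⟩ʳ_)
open import Data.List using (List; []; _∷_; length; map; concatMap; _++_; foldr; take; lookup; allFin)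
open import Data.Nat.ListAction using (sum)
open import Data.List.Relation.Unary.All as All using (All; []; _∷_)
open import Data.List.Relation.Unary.Unique.Propositional using (Unique)
open import Data.List.Membership.Propositional using (_∈_)
open import Data.List.Relation.Binary.Sublist.Propositional as SL using (_⊆_)
open import Data.Vec using (Vec; tabulate) renaming (lookup to vlookup; [] to v[]; _∷_ to _v∷_)
open import Data.Sum using (_⊎_; inj₁; inj₂)
open import Data.Product using (_×_; _,_)
open import Relation.Binary.Definitions using (DecidableEquality)
open import Relation.Binary.PropositionalEquality using (_≡_; _≢_; refl; subst; sym)
open import Relation.Nullary.Decidable using (⌊_⌋)
open import Function.Bundles using (_↔_; Inverse)

record Graph : Set₁ where
  field
    V          : Set
    _≟_        : DecidableEquality V
    verts      : List V
    complete   : ∀ v → v ∈ verts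
    unique     : Unique verts
    adj        : V → V → Bool
    adj-sym    : ∀ u v → adj u v ≡ adj v u
    adj-irrefl : ∀ v → adj v v ≡ false

open Graph public

filterᵇ : {A : Set} → (A → Bool) → List A → List A
filterᵇ p [] = []
filterᵇ p (x ∷ xs) = if p x then x ∷ filterᵇ p xs else filterᵇ p xs

sublists : {A : Set} → List A → List (List A)
sublists [] = [] ∷ []
sublists (x ∷ xs) = map (x ∷_) (sublists xs) ++ sublists xs

maxL : List ℕ → ℕ
maxL = foldr _⊔_ 0

-- |I(S)| for S given as a duplicate-free list of vertices
edgesL : {V : Set} → (V → V → Bool) → List V → ℕ
edgesL adj [] = 0
edgesL adj (x ∷ xs) = length (filterᵇ (adj x) xs) + edgesL adj xs

Iw : {V : Set} → List V → (V → V → Bool) → (V → Bool) → ℕ → ℕ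
Iw vs adj W m = maxL (map (edgesL adj) (filterᵇ (λ s → length s ≡ᵇ m) (sublists (filterᵇ W vs))))

δw : {V : Set} → List V → (V → V → Bool) → (V → Bool) → ℕ → ℕ
δw vs adj W zero = 0
δw vs adj W (suc zero) = 0
δw vs adj W (suc (suc m)) = Iw vs adj W (suc (suc m)) ∸ Iw vs adj W (suc m)

-- An order on W is given by its strict comparison lt (lt x y ≡ true iff x < y).
-- rank of x among W (0-based) and the initial segment O[1,k] of W.
rankIn : {V : Set} → List V → (V → Bool) → (V → V → Bool) → V → ℕ
rankIn vs W lt x = length (filterᵇ (λ y → lt y x) (filterᵇ W vs))

initial : {V : Set} → List V → (V → Bool) → (V → V → Bool) → ℕ → List V
initial vs W lt k = filterᵇ (λ x → rankIn vs W lt x <ᵇ k) (filterᵇ W vs)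

record StrictTotalOn {V : Set} (W : V → Bool) (lt : V → V → Bool) : Set where
  field
    irrefl : ∀ x → W x ≡ true → lt x x ≡ false
    trans  : ∀ x y z → W x ≡ true → W y ≡ true → W z ≡ true →
             lt x y ≡ true → lt y z ≡ true → lt x z ≡ true
    total  : ∀ x y → W x ≡ true → W y ≡ true → x ≢ y →
             (lt x y ≡ true) ⊎ (lt y x ≡ true)

IsOptimal : {V : Set} → List V → (V → V → Bool) → (V → Bool) → (V → V → Bool) → Set
IsOptimal vs adj W lt =
  StrictTotalOn W lt ×
  (∀ k → k ≤ length (filterᵇ W vs) → edgesL adj (initial vs W lt k) ≡ Iw vs adj W k)

Order : Graph → Set
Order G = V G ↔ Fin (length (verts G))

rank : (G : Graph) → Order G → V G → ℕ
rank G O v = toℕ (Inverse.to O v)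

ltO : (G : Graph) → Order G → V G → V G → Bool
ltO G O u v = rank G O u <ᵇ rank G O v

allV : {V : Set} → V → Bool
allV _ = true

IsOptimalOrder : (G : Graph) → Order G → Set
IsOptimalOrder G O = IsOptimal (verts G) (adj G) allV (ltO G O)

I : Graph → ℕ → ℕ
I G = Iw (verts G) (adj G) allV

δ : Graph → ℕ → ℕ
δ G = δw (verts G) (adj G) allV

-- Partitions into consecutive intervals, given by the list of part lengths.
-- Part p occupies (0-based) positions off p, …, off p + len p - 1, so its
-- 1-based start is a_p = off p + 1.

nParts : List ℕ → ℕ
nParts = length

off : (lens : List ℕ) → Fin (nParts lens) → ℕ
off lens p = sum (take (toℕ p) lens)

plen : (lens : List ℕ) → Fin (nParts lens) → ℕ
plen lens p = lookup lens p

inPart : (G : Graph) → Order G → (lens : List ℕ) → Fin (nParts lens) → V G → Bool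
inPart G O lens p v = (off lens p ≤ᵇ rank G O v) ∧ (rank G O v <ᵇ off lens p + plen lens p)

record IsIsoPartition (G : Graph) (O : Order G) (lens : List ℕ) : Set where
  field
    lens-pos : All (λ l → 0 < l) lens
    lens-sum : sum lens ≡ length (verts G)
    part-opt : ∀ p → IsOptimal (verts G) (adj G) (inPart G O lens p) (ltO G O)
    part-nbrs : ∀ p v → inPart G O lens p v ≡ true →
      length (filterᵇ (λ u → (rank G O u <ᵇ off lens p) ∧ adj G u v) (verts G))
        ≡ δ G (suc (off lens p))

NonDecreasing : (G : Graph) → Order G → List ℕ → Set
NonDecreasing G O lens = ∀ p m → 1 ≤ m → m < plen lens p →
  δw (verts G) (adj G) (inPart G O lens p) m ≤ δw (verts G) (adj G) (inPart G O lens p) (suc m)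

Regular : (G : Graph) → Order G → List ℕ → Set
Regular G O lens = ∀ (f l : Fin (nParts lens)) → toℕ f ≡ 0 → suc (toℕ l) ≡ nParts lens →
  (plen lens f ≡ plen lens l) ×
  (∀ m → 1 ≤ m → m ≤ plen lens f →
     δw (verts G) (adj G) (inPart G O lens f) m ≡ δw (verts G) (adj G) (inPart G O lens l) m)

partIdx : (lens : List ℕ) → Fin (sum lens) → Fin (nParts lens)
partIdx [] ()
partIdx (l ∷ ls) i with splitAt l i
... | inj₁ _ = Fin.zero
... | inj₂ j = Fin.suc (partIdx ls j)

partOf : (G : Graph) (O : Order G) (lens : List ℕ) → IsIsoPartition G O lens →
         V G → Fin (nParts lens)
partOf G O lens P v =
  partIdx lens (subst Fin (sym (IsIsoPartition.lens-sum P)) (Inverse.to O v))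

-- Products.  An index set S = {i₁ < … < i_k} ⊆ {0,…,d-1} is a sublist `is`
-- of allFin d; vertices of G_S are tuples All (V ∘ G) is.

module Product {d : ℕ} (G : Fin d → Graph) (O : (i : Fin d) → Order (G i))
               (P : Fin d → List ℕ) (isP : ∀ i → IsIsoPartition (G i) (O i) (P i)) where

  Tup : List (Fin d) → Set
  Tup is = All (λ i → V (G i)) is

  allT : (is : List (Fin d)) → List (Tup is)
  allT [] = [] ∷ []
  allT (i ∷ is) = concatMap (λ x → map (x ∷_) (allT is)) (verts (G i))

  eqT : (is : List (Fin d)) → Tup is → Tup is → Bool
  eqT [] [] [] = true
  eqT (i ∷ is) (x ∷ xs) (y ∷ ys) = ⌊ _≟_ (G i) x y ⌋ ∧ eqT is xs ys

  adjT : (is : List (Fin d)) → Tup is → Tup is → Bool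
  adjT [] [] [] = false
  adjT (i ∷ is) (x ∷ xs) (y ∷ ys) =
    (adj (G i) x y ∧ eqT is xs ys) ∨ (⌊ _≟_ (G i) x y ⌋ ∧ adjT is xs ys)

  Block : List (Fin d) → Set
  Block is = All (λ i → Fin (nParts (P i))) is

  inBlock : (is : List (Fin d)) → Block is → Tup is → Bool
  inBlock [] [] [] = true
  inBlock (i ∷ is) (p ∷ ps) (x ∷ xs) = inPart (G i) (O i) (P i) p x ∧ inBlock is ps xs

  blockOf : (is : List (Fin d)) → Tup is → Block is
  blockOf is = All.map (λ {i} x → partOf (G i) (O i) (P i) (isP i) x)

  sameBlock : (is : List (Fin d)) → Block is → Block is → Bool
  sameBlock [] [] [] = true
  sameBlock (i ∷ is) (p ∷ ps) (q ∷ qs) = (toℕ p ≡ᵇ toℕ q) ∧ sameBlock is ps qs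

  starts : (is : List (Fin d)) → Block is → List ℕ
  starts [] [] = []
  starts (i ∷ is) (p ∷ ps) = off (P i) p ∷ starts is ps

  ranks : (is : List (Fin d)) → Tup is → Vec ℕ (length is)
  ranks [] [] = v[]
  ranks (i ∷ is) (x ∷ xs) = rank (G i) (O i) x v∷ ranks is xs

  lexLt : List ℕ → List ℕ → Bool
  lexLt [] _ = false
  lexLt (_ ∷ _) [] = false
  lexLt (a ∷ as) (b ∷ bs) = (a <ᵇ b) ∨ ((a ≡ᵇ b) ∧ lexLt as bs)

  permuteL : {k : ℕ} → Permutation′ k → Vec ℕ k → List ℕ
  permuteL {k} π r = Data.List.tabulate (λ j → vlookup r (π ⟨$⟩ʳ j))

  Dlt : (is : List (Fin d)) → Permutation′ (length is) → Tup is → Tup is → Bool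
  Dlt is π x y = lexLt (permuteL π (ranks is x)) (permuteL π (ranks is y))

  restrict : {A : Fin d → Set} {is js : List (Fin d)} → is ⊆ js → All A js → All A is
  restrict SL.[] [] = []
  restrict (y SL.∷ʳ σ) (_ ∷ xs) = restrict σ xs
  restrict {A} (refl SL.∷ σ) (x ∷ xs) = x ∷ restrict σ xs

  EqOutside : {is js : List (Fin d)} → is ⊆ js → Tup js → Tup js → Set
  EqOutside SL.[] [] [] = Data.Unit.⊤ where import Data.Unit
  EqOutside (y SL.∷ʳ σ) (x₁ ∷ xs) (y₁ ∷ ys) = (x₁ ≡ y₁) × EqOutside σ xs ys
  EqOutside (refl SL.∷ σ) (_ ∷ xs) (_ ∷ ys) = EqOutside σ xs ys

  Consistent : {is js : List (Fin d)} → is ⊆ js → (Tup js → Bool) →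
               (Tup js → Tup js → Bool) → (Tup is → Tup is → Bool) → Set
  Consistent σ W lt lt' = ∀ x y → W x ≡ true → W y ≡ true → lt x y ≡ true →
    EqOutside σ x y → lt' (restrict σ x) (restrict σ y) ≡ true

  record DominationCollection : Set where
    field
      πB : (is : List (Fin d)) → Block is → Permutation′ (length is)
      dom-opt : ∀ is → is ⊆ allFin d → is ≢ [] → ∀ (B : Block is) →
        IsOptimal (allT is) (adjT is) (inBlock is B) (Dlt is (πB is B))
      dom-cons : ∀ is js → (σ : is ⊆ js) → js ⊆ allFin d → is ≢ [] → ∀ (B : Block js) →
        Consistent σ (inBlock js B) (Dlt js (πB js B)) (Dlt is (πB is (restrict σ B)))

  BL : DominationCollection → (is : List (Fin d)) → Tup is → Tup is → Bool
  BL D is x y =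
    if sameBlock is (blockOf is x) (blockOf is y)
    then Dlt is (DominationCollection.πB D is (blockOf is x)) x y
    else lexLt (starts is (blockOf is x)) (starts is (blockOf is y))

  -- middle indices 2,…,d-1 (1-based), i.e. 1,…,d-2 (0-based)
  middle : List (Fin d)
  middle = filterᵇ (λ i → (1 ≤ᵇ toℕ i) ∧ (suc (toℕ i) <ᵇ d)) (allFin d)

  AllB : (is : List (Fin d)) → (∀ i → Fin (nParts (P i)) → Set) → Block is → Set
  AllB [] Q [] = Data.Unit.⊤ where import Data.Unit
  AllB (i ∷ is) Q (p ∷ ps) = Q i p × AllB is Q ps

  record IsRegularDC (D : DominationCollection) : Set where
    field
      regular : ∀ i → 1 ≤ toℕ i → toℕ i + 2 ≤ d → Regular (G i) (O i) (P i)
      same-π  : ∀ (B₁ B₂ : Block middle) →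
        AllB middle (λ i p → toℕ p ≡ 0) B₁ →
        AllB middle (λ i p → suc (toℕ p) ≡ nParts (P i)) B₂ →
        ∀ j → DominationCollection.πB D middle B₁ ⟨$⟩ʳ j ≡ DominationCollection.πB D middle B₂ ⟨$⟩ʳ j

-- x and y agree outside S, so they lie in a common block of G exactly when their
-- restrictions lie in a common block of G_S, and the lexicographic comparison of
-- block starts is unaffected by the coordinates outside S, where the starts
-- coincide.  Inside a block, BL compares by D_B, and the domination collection
-- requires D_B to be consistent with the order D_{B|S} of the restricted block.
module Submission where

open import Defs
open import Data.Nat using (ℕ; zero; suc; _≤_; _<_; _+_; _≡ᵇ_; _<ᵇ_; z≤n)
open import Data.Nat.Properties
  using (≡ᵇ⇒≡; ≡⇒≡ᵇ; ≤⇒≤ᵇ; <⇒<ᵇ; +-monoʳ-≤; +-monoʳ-<; +-assoc)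
open import Data.Nat.ListAction using (sum)
open import Data.Fin using (Fin; toℕ; splitAt)
open import Data.Fin.Properties
  using (toℕ-↑ˡ; toℕ-↑ʳ; splitAt⁻¹-↑ˡ; splitAt⁻¹-↑ʳ; toℕ<n; toℕ-injective; toℕ-cast; subst-is-cast)
open import Data.Bool using (true; false; _∧_; _∨_)
open import Data.Bool.Properties using (T-≡)
open import Data.Product using (_×_; _,_)
open import Data.Sum using (inj₁; inj₂)
open import Data.List using (List; []; _∷_; length; allFin)
open import Data.List.Relation.Unary.All using ([]; _∷_)
open import Data.List.Relation.Binary.Sublist.Propositional using (_⊆_; []; _∷_; _∷ʳ_; ⊆-refl)
open import Function.Bundles using (module Inverse; module Equivalence)
open import Relation.Binary.PropositionalEquality
  using (_≡_; _≢_; refl; sym; trans; cong; cong₂; subst)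

≡ᵇ-refl : ∀ n → (n ≡ᵇ n) ≡ true
≡ᵇ-refl n = Equivalence.to T-≡ (≡⇒≡ᵇ n n refl)

toℕ-subst : ∀ {m n} (e : m ≡ n) (i : Fin m) → toℕ (subst Fin e i) ≡ toℕ i
toℕ-subst e i = trans (cong toℕ (subst-is-cast e i)) (toℕ-cast e i)

partIdx-bounds : ∀ lens (i : Fin (sum lens)) →
  off lens (partIdx lens i) ≤ toℕ i × toℕ i < off lens (partIdx lens i) + plen lens (partIdx lens i)
partIdx-bounds (l ∷ ls) i with splitAt l i in split
... | inj₁ j = z≤n , subst (_< l) i≡j (toℕ<n j)
  where
  i≡j : toℕ j ≡ toℕ i
  i≡j = trans (sym (toℕ-↑ˡ j _)) (cong toℕ (splitAt⁻¹-↑ˡ split))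
... | inj₂ j with partIdx-bounds ls j
...   | off≤j , j<end = subst (_ ≤_) i≡l+j (+-monoʳ-≤ l off≤j)
                      , subst (_< _) i≡l+j (subst (l + toℕ j <_) (sym (+-assoc l _ _)) (+-monoʳ-< l j<end))
  where
  i≡l+j : l + toℕ j ≡ toℕ i
  i≡l+j = trans (sym (toℕ-↑ʳ l j)) (cong toℕ (splitAt⁻¹-↑ʳ split))

inPart-partOf : ∀ G O lens (isP : IsIsoPartition G O lens) v →
  inPart G O lens (partOf G O lens isP v) v ≡ true
inPart-partOf G O lens isP v
  with partIdx-bounds lens (subst Fin (sym (IsIsoPartition.lens-sum isP)) (Inverse.to O v))
... | off≤v , v<end rewrite toℕ-subst (sym (IsIsoPartition.lens-sum isP)) (Inverse.to O v)
  = cong₂ _∧_ (Equivalence.to T-≡ (≤⇒≤ᵇ off≤v)) (Equivalence.to T-≡ (<⇒<ᵇ v<end))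

module Consistency {d : ℕ} (G : Fin d → Graph) (O : (i : Fin d) → Order (G i))
                   (P : Fin d → List ℕ) (isP : ∀ i → IsIsoPartition (G i) (O i) (P i)) where
  open Product G O P isP

  lexLt-∷-cancel : ∀ a as bs → lexLt (a ∷ as) (a ∷ bs) ≡ lexLt as bs
  lexLt-∷-cancel zero    as bs = refl
  lexLt-∷-cancel (suc a) as bs = lexLt-∷-cancel a as bs

  inBlock-blockOf : ∀ is (x : Tup is) → inBlock is (blockOf is x) x ≡ true
  inBlock-blockOf []       []       = refl
  inBlock-blockOf (i ∷ is) (x ∷ xs) rewrite inPart-partOf (G i) (O i) (P i) (isP i) x =
    inBlock-blockOf is xs

  sameBlock⇒≡ : ∀ is (b c : Block is) → sameBlock is b c ≡ true → b ≡ c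
  sameBlock⇒≡ []       []       []       _ = refl
  sameBlock⇒≡ (i ∷ is) (p ∷ ps) (q ∷ qs) same with toℕ p ≡ᵇ toℕ q in p≡q
  ... | true = cong₂ _∷_ (toℕ-injective (≡ᵇ⇒≡ _ _ (Equivalence.from T-≡ p≡q)))
                         (sameBlock⇒≡ is ps qs same)

  blockOf-restrict : ∀ {is js} (σ : is ⊆ js) (x : Tup js) →
    blockOf is (restrict σ x) ≡ restrict σ (blockOf js x)
  blockOf-restrict []         []       = refl
  blockOf-restrict (_ ∷ʳ σ)   (_ ∷ xs) = blockOf-restrict σ xs
  blockOf-restrict (refl ∷ σ) (_ ∷ xs) = cong (_ ∷_) (blockOf-restrict σ xs)

  sameBlock-restrict : ∀ {is js} (σ : is ⊆ js) (x y : Tup js) → EqOutside σ x y →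
    sameBlock js (blockOf js x) (blockOf js y)
      ≡ sameBlock is (blockOf is (restrict σ x)) (blockOf is (restrict σ y))
  sameBlock-restrict []         []       []        _           = refl
  sameBlock-restrict {js = j ∷ _} (_ ∷ʳ σ) (x ∷ xs) (.x ∷ ys) (refl , eo)
    rewrite ≡ᵇ-refl (toℕ (partOf (G j) (O j) (P j) (isP j) x)) = sameBlock-restrict σ xs ys eo
  sameBlock-restrict (refl ∷ σ) (_ ∷ xs) (_ ∷ ys) eo = cong (_ ∧_) (sameBlock-restrict σ xs ys eo)

  startsLt-restrict : ∀ {is js} (σ : is ⊆ js) (x y : Tup js) → EqOutside σ x y →
    lexLt (starts js (blockOf js x)) (starts js (blockOf js y))
      ≡ lexLt (starts is (blockOf is (restrict σ x))) (starts is (blockOf is (restrict σ y)))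
  startsLt-restrict []         []       []        _           = refl
  startsLt-restrict {js = j ∷ js} (_ ∷ʳ σ) (x ∷ xs) (.x ∷ ys) (refl , eo) =
    trans (lexLt-∷-cancel (off (P j) (partOf (G j) (O j) (P j) (isP j) x))
                          (starts js (blockOf js xs)) (starts js (blockOf js ys)))
          (startsLt-restrict σ xs ys eo)
  startsLt-restrict {js = j ∷ _} (refl ∷ σ) (x ∷ xs) (y ∷ ys) eo =
    cong (λ b → (a <ᵇ a′) ∨ ((a ≡ᵇ a′) ∧ b)) (startsLt-restrict σ xs ys eo)
    where
    a a′ : ℕ
    a  = off (P j) (partOf (G j) (O j) (P j) (isP j) x)
    a′ = off (P j) (partOf (G j) (O j) (P j) (isP j) y)

  BL-consistent : (D : DominationCollection) → ∀ {is js} (σ : is ⊆ js) →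
    js ⊆ allFin d → is ≢ [] → Consistent σ allV (BL D js) (BL D is)
  BL-consistent D {is} {js} σ js⊆ is≢[] x y _ _ x<y eo
    with sameBlock js (blockOf js x) (blockOf js y) in same
       | sameBlock is (blockOf is (restrict σ x)) (blockOf is (restrict σ y))
       | sameBlock-restrict σ x y eo
  ... | false | _ | refl = trans (sym (startsLt-restrict σ x y eo)) x<y
  ... | true  | _ | refl rewrite blockOf-restrict σ x =
    DominationCollection.dom-cons D is js σ js⊆ is≢[] (blockOf js x) x y
      (inBlock-blockOf js x) y∈Bx x<y eo
    where
    y∈Bx : inBlock js (blockOf js x) y ≡ true
    y∈Bx = subst (λ B → inBlock js B y ≡ true)
                 (sym (sameBlock⇒≡ js _ _ same)) (inBlock-blockOf js y)

lemma7 : (d : ℕ) → 3 ≤ d →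
    (G : Fin d → Graph) → (O : (i : Fin d) → Order (G i)) →
    (∀ i → IsOptimalOrder (G i) (O i)) →
    (P : Fin d → List ℕ) → (isP : ∀ i → IsIsoPartition (G i) (O i) (P i)) →
    (D : Product.DominationCollection G O P isP) →
    Product.IsRegularDC G O P isP D →
    (∀ i → toℕ i + 2 ≤ d → NonDecreasing (G i) (O i) (P i)) →
    (∀ is → is ⊆ allFin d → length is ≡ 2 →
      IsOptimal (Product.allT G O P isP is) (Product.adjT G O P isP is) allV
        (Product.BL G O P isP D is)) →
    ∀ is → (σ : is ⊆ allFin d) → is ≢ [] →
      Product.Consistent G O P isP σ allV
        (Product.BL G O P isP D (allFin d)) (Product.BL G O P isP D is)
lemma7 d _ G O _ P isP D _ _ _ is σ =
  Consistency.BL-consistent G O P isP D σ ⊆-refl
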